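{- Let $k,t,q$ be integers such that $q\ge 2$ and $k>t\ge 2$, and let $s\ge 0$ be an integer. If $s<\bigl(R_q(k-t+1,k,\ldots,k)-q(k-t)\bigr)/(qt)$, then $K_k$ and $K_k+sK_t$ are $q$-equivalent.
   Context: All graphs are finite and simple. $K_k+sK_t$ denotes the vertex-disjoint union of a copy of $K_k$ and $s$ copies of $K_t$. For integers $q\ge 2$ and $k_1,\dots,k_q\ge 2$, $R(k_1,\dots,k_q)$ is the smallest $n$ such that every colouring of the edges of $K_n$ with colours $[q]$ contains, for some $i\in[q]$, a copy of $K_{k_i}$ all of whose edges have colour $i$; $R_q(k_1,k_2,\ldots,k_2)$ denotes $R(k_1,\dots,k_q)$ with $k_2=\dots=k_q$. A graph $G$ is $q$-Ramsey for $H$ if every $q$-colouring of $E(G)$ contains a monochromatic copy of $H$; $G$ is $q$-Ramsey-minimal for $H$ if it is $q$-Ramsey for $H$ but no proper subgraph is; $\mathcal{M}_q(H)$ is the set of such graphs. $H,H'$ are $q$-equivalent if $\mathcal{M}_q(H)=\mathcal{M}_q(H')$. -}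

module Defs where

open import Data.Nat using (ℕ; zero; suc; _+_; _*_; _∸_; _≤_; _<_)
open import Data.Fin using (Fin; zero; suc; splitAt; _≟_)
open import Data.Bool using (Bool; true; false; not)
open import Data.Sum using (_⊎_; inj₁; inj₂)
open import Data.Product using (Σ; _×_; _,_; ∃)
open import Function.Definitions using (Injective)
open import Relation.Nullary using (¬_; does)
open import Relation.Nullary.Decidable using (dec-false)
open import Relation.Binary.PropositionalEquality using (_≡_; refl; sym)
open import Data.Empty using (⊥)

record Graph (n : ℕ) : Set where
  field
    adj    : Fin n → Fin n → Bool
    adj-sym : ∀ u v → adj u v ≡ adj v u
    adj-irrefl : ∀ u → adj u u ≡ false
open Graph public

private
  ≟-sym : ∀ {n} (u v : Fin n) → not (does (u ≟ v)) ≡ not (does (v ≟ u))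
  ≟-sym u v with u ≟ v | v ≟ u
  ... | Relation.Nullary.yes _ | Relation.Nullary.yes _ = refl
  ... | Relation.Nullary.no _  | Relation.Nullary.no _  = refl
  ... | Relation.Nullary.yes p | Relation.Nullary.no q = Data.Empty.⊥-elim (q (sym p))
    where import Data.Empty
  ... | Relation.Nullary.no p  | Relation.Nullary.yes q = Data.Empty.⊥-elim (p (sym q))
    where import Data.Empty

  ≟-refl : ∀ {n} (u : Fin n) → not (does (u ≟ u)) ≡ false
  ≟-refl u with u ≟ u
  ... | Relation.Nullary.yes _ = refl
  ... | Relation.Nullary.no p = Data.Empty.⊥-elim (p refl)
    where import Data.Empty

K : (n : ℕ) → Graph n
K n = record { adj = λ u v → not (does (u ≟ v)) ; adj-sym = ≟-sym ; adj-irrefl = ≟-refl }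

-- Vertex-disjoint union: vertices of G come first, then those of H
private
  uadj : ∀ {m n} → Graph m → Graph n → Fin m ⊎ Fin n → Fin m ⊎ Fin n → Bool
  uadj G H (inj₁ a) (inj₁ b) = adj G a b
  uadj G H (inj₂ a) (inj₂ b) = adj H a b
  uadj G H (inj₁ _) (inj₂ _) = false
  uadj G H (inj₂ _) (inj₁ _) = false

  uadj-sym : ∀ {m n} (G : Graph m) (H : Graph n) x y → uadj G H x y ≡ uadj G H y x
  uadj-sym G H (inj₁ a) (inj₁ b) = adj-sym G a b
  uadj-sym G H (inj₂ a) (inj₂ b) = adj-sym H a b
  uadj-sym G H (inj₁ _) (inj₂ _) = refl
  uadj-sym G H (inj₂ _) (inj₁ _) = refl

  uadj-irr : ∀ {m n} (G : Graph m) (H : Graph n) x → uadj G H x x ≡ false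
  uadj-irr G H (inj₁ a) = adj-irrefl G a
  uadj-irr G H (inj₂ a) = adj-irrefl H a

_⊕_ : ∀ {m n} → Graph m → Graph n → Graph (m + n)
_⊕_ {m} G H = record
  { adj = λ u v → uadj G H (splitAt m u) (splitAt m v)
  ; adj-sym = λ u v → uadj-sym G H (splitAt m u) (splitAt m v)
  ; adj-irrefl = λ u → uadj-irr G H (splitAt m u) }

copies : ∀ {n} (s : ℕ) → Graph n → Graph (s * n)
copies zero    G = K 0
copies (suc s) G = G ⊕ copies s G

KplusSK : (k s t : ℕ) → Graph (k + s * t)
KplusSK k s t = K k ⊕ copies s (K t)

-- a q-colouring of the edges of a graph on Fin n (given on all pairs,
-- symmetric; only values on edges matter)
Colouring : ℕ → ℕ → Set
Colouring q n = Fin n → Fin n → Fin q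

SymColouring : ∀ {q n} → Colouring q n → Set
SymColouring c = ∀ u v → c u v ≡ c v u

MonoCopy : ∀ {q h n} → Graph h → Graph n → Colouring q n → Fin q → Set
MonoCopy {h = h} {n = n} H G c i =
  Σ (Fin h → Fin n) λ f → Injective _≡_ _≡_ f ×
    (∀ x y → adj H x y ≡ true → (adj G (f x) (f y) ≡ true) × (c (f x) (f y) ≡ i))

IsRamsey : ∀ {h n} (q : ℕ) → Graph h → Graph n → Set
IsRamsey {n = n} q H G =
  (c : Colouring q n) → SymColouring c → ∃ λ (i : Fin q) → MonoCopy H G c i

-- G' (on Fin m) is a subgraph of G via the injective edge-preserving map g;
-- it is the whole of G iff g is onto vertices and onto edges.
IsSubgraphVia : ∀ {m n} → Graph m → Graph n → (Fin m → Fin n) → Set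
IsSubgraphVia G' G g =
  Injective _≡_ _≡_ g × (∀ u v → adj G' u v ≡ true → adj G (g u) (g v) ≡ true)

IsWholeVia : ∀ {m n} → Graph m → Graph n → (Fin m → Fin n) → Set
IsWholeVia {m} G' G g =
  (∀ v → Σ (Fin m) λ u → g u ≡ v) ×
  (∀ u v → adj G u v ≡ true →
     Σ (Fin m) λ u' → Σ (Fin m) λ v' → g u' ≡ u × g v' ≡ v × adj G' u' v' ≡ true)

IsRamseyMinimal : ∀ {h n} (q : ℕ) → Graph h → Graph n → Set
IsRamseyMinimal {n = n} q H G =
  IsRamsey q H G ×
  (∀ (m : ℕ) (G' : Graph m) (g : Fin m → Fin n) →
     IsSubgraphVia G' G g → ¬ IsWholeVia G' G g → ¬ IsRamsey q H G')

QEquivalent : ∀ {h h'} (q : ℕ) → Graph h → Graph h' → Set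
QEquivalent q H H' =
  ∀ (n : ℕ) (G : Graph n) →
    (IsRamseyMinimal q H G → IsRamseyMinimal q H' G) ×
    (IsRamseyMinimal q H' G → IsRamseyMinimal q H G)

Arrows : (q n : ℕ) → (Fin q → ℕ) → Set
Arrows q n ks =
  (c : Colouring q n) → SymColouring c → ∃ λ (i : Fin q) → MonoCopy (K (ks i)) (K n) c i

IsRamseyNumber : (q : ℕ) → (Fin q → ℕ) → ℕ → Set
IsRamseyNumber q ks r = Arrows q r ks × (∀ n → Arrows q n ks → r ≤ n)

firstThenRest : (q : ℕ) → ℕ → ℕ → Fin q → ℕ
firstThenRest q a b zero    = a
firstThenRest q a b (suc _) = b

-- G is q-Ramsey for K_k iff it is q-Ramsey for K_k + sK_t, so the two minimal families agree;
-- only "K_k ⇒ K_k + sK_t" needs work. Let c colour G without a monochromatic K_k + sK_t.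
-- For each colour i with a monochromatic K_k, add vertex-disjoint monochromatic K_t's of colour i
-- greedily; this stops after fewer than s steps at a set Y_i of at most k + (s−1)t vertices meeting
-- every monochromatic K_t of colour i. The union Y of the Y_i has fewer than R_q(k−t+1, k, …, k)
-- vertices, so some colouring ψ of the complete graph on Y has no K_{k−t+1} in colour 1 and no K_k
-- in the others. Pick i₀ with a monochromatic K_k under c and recolour G: by ψ inside Y (colours 1
-- and i₀ swapped), by i₀ between Y and the rest, and by c outside Y. A monochromatic K_k of colour
-- i₀ would have k−t+1 vertices in Y (excluded by ψ) or t outside Y (excluded by Y_{i₀}); one of any
-- other colour lies entirely inside Y (excluded by ψ) or entirely outside (excluded by Y_i).
module Submission where

open import Defs
open import Data.Nat as ℕ using (ℕ; zero; suc; z≤n; _+_; _*_; _∸_; _≤_; _<_)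
open import Data.Nat.Properties as ℕₚ
  using (≤-trans; ≤-reflexive; +-identityʳ; ≤-pred; m≤n+m; +-monoʳ-≤; +-mono-≤; *-monoˡ-≤;
         <⇒≱; <⇒≤; ≤-<-trans; m+n∸m≡n; +-suc; +-assoc; m∸n+n≡m; m+[n∸m]≡n)
open import Data.Nat.Tactic.RingSolver using (solve-∀)
open import Data.Fin as Fin using (Fin; zero; suc; splitAt; join; _↑ˡ_; _↑ʳ_; inject≤)
open import Data.Fin.Properties
  using (any?; all?; ¬∀⟶∃¬; suc-injective; splitAt-↑ˡ; splitAt-↑ʳ; join-splitAt;
         ↑ˡ-injective; ↑ʳ-injective; inject≤-injective)
open import Data.Fin.Permutation using (Permutation′; transpose; _⟨$⟩ʳ_; _⟨$⟩ˡ_; inverseˡ; inverseʳ)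
open import Data.Vec.Functional using ([]; _∷_)
open import Data.Bool as Bool using (true)
open import Data.List as List using (List; length; lookup; tabulate; concat)
open import Data.List.Properties using (length-++; length-tabulate)
open import Data.List.Membership.Propositional using (_∈_; _∉_)
open import Data.List.Membership.Propositional.Properties using (∈-concat⁺′; ∈-tabulate⁺)
open import Data.List.Relation.Unary.Any using (index)
open import Data.List.Relation.Unary.Any.Properties using (lookup-index)
open import Data.Sum as Sum using (_⊎_; inj₁; inj₂; [_,_]′)
open import Data.Product as Product using (Σ; _×_; _,_; ∃; proj₁; proj₂)
open import Data.Empty using (⊥; ⊥-elim)
open import Function using (_∘_)
open import Function.Definitions using (Injective)
open import Relation.Nullary using (¬_; Dec; yes; no; ¬?; contradiction)
open import Relation.Nullary.Decidable using (map′; _×-dec_; _→-dec_; dec-false)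
open import Relation.Unary using (Decidable)
open import Relation.Binary.PropositionalEquality
  using (_≡_; _≢_; _≗_; refl; sym; trans; cong; subst; module ≡-Reasoning)

∃-map? : ∀ h {n} (P : (Fin h → Fin n) → Set) → (∀ {f g} → f ≗ g → P f → P g) →
         (∀ f → Dec (P f)) → Dec (∃ P)
∃-map? zero    P resp P? = map′ ([] ,_) (λ (f , p) → resp (λ ()) p) (P? [])
∃-map? (suc h) P resp P? =
  map′ (λ (a , f , p) → a ∷ f , p)
       (λ (f , p) → f zero , f ∘ suc , resp (λ { zero → refl ; (suc x) → refl }) p)
       (any? λ a → ∃-map? h (P ∘ (a ∷_)) (λ e → resp λ { zero → refl ; (suc x) → e x }) (P? ∘ (a ∷_)))

length-concat-tabulate-≤ : ∀ {A : Set} q (F : Fin q → List A) {b} →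
  (∀ i → length (F i) ≤ b) → length (concat (tabulate F)) ≤ q * b
length-concat-tabulate-≤ zero    F bound = z≤n
length-concat-tabulate-≤ (suc q) F bound rewrite length-++ (F zero) {concat (tabulate (F ∘ suc))} =
  +-mono-≤ (bound zero) (length-concat-tabulate-≤ q (F ∘ suc) (bound ∘ suc))

Embeds : ∀ {k} → (Fin k → Set) → ℕ → Set
Embeds {k} P a = Σ (Fin a → Fin k) λ g → Injective _≡_ _≡_ g × (∀ x → P (g x))

Embeds-zero : ∀ {k} (P : Fin k → Set) → Embeds P 0
Embeds-zero P = [] , (λ { {()} }) , λ ()

Embeds-suc : ∀ {k a} {P : Fin (suc k) → Set} → Embeds (P ∘ suc) a → Embeds P a
Embeds-suc (g , g-inj , pg) = suc ∘ g , g-inj ∘ suc-injective , pg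

Embeds-cons : ∀ {k a} {P : Fin (suc k) → Set} → P zero → Embeds (P ∘ suc) a → Embeds P (suc a)
Embeds-cons {P = P} p₀ (g , g-inj , pg) = zero ∷ suc ∘ g , inj , ∈P
  where
  inj : Injective _≡_ _≡_ (zero ∷ suc ∘ g)
  inj {zero}  {zero}  e = refl
  inj {suc x} {suc y} e = cong suc (g-inj (suc-injective e))
  inj {zero}  {suc y} ()
  inj {suc x} {zero}  ()
  ∈P : ∀ x → P ((zero ∷ suc ∘ g) x)
  ∈P zero    = p₀
  ∈P (suc x) = pg x

Embeds-split : ∀ k (P : Fin k → Set) → Decidable P → ∀ a b → a + b ≤ suc k →
  Embeds P a ⊎ Embeds (¬_ ∘ P) b
Embeds-split k       P P? zero    b       _ = inj₁ (Embeds-zero P)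
Embeds-split k       P P? (suc a) zero    _ = inj₂ (Embeds-zero (¬_ ∘ P))
Embeds-split zero    P P? (suc a) (suc b) (ℕ.s≤s a+b≤0)
  with () ← ≤-trans (≤-reflexive (sym (+-suc a b))) a+b≤0
Embeds-split (suc k) P P? (suc a) (suc b) a+b≤k+1 with P? zero
... | yes p₀ = Sum.map (Embeds-cons {P = P} p₀) (Embeds-suc {P = ¬_ ∘ P})
                 (Embeds-split k (P ∘ suc) (P? ∘ suc) a (suc b) (≤-pred a+b≤k+1))
... | no ¬p₀ = Sum.map (Embeds-suc {P = P}) (Embeds-cons {P = ¬_ ∘ P} ¬p₀)
                 (Embeds-split k (P ∘ suc) (P? ∘ suc) (suc a) b
                   (≤-pred (≤-trans (≤-reflexive (cong suc (sym (+-suc a b)))) a+b≤k+1)))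

record IsMonoCopy {q h n} (H : Graph h) (G : Graph n) (c : Colouring q n) (i : Fin q)
                  (f : Fin h → Fin n) : Set where
  constructor _,_
  field
    injective : Injective _≡_ _≡_ f
    edge      : ∀ x y → adj H x y ≡ true → adj G (f x) (f y) ≡ true × c (f x) (f y) ≡ i

module _ {q h n} {H : Graph h} {G : Graph n} {c : Colouring q n} {i : Fin q} where

  toMonoCopy : ∃ (IsMonoCopy H G c i) → MonoCopy H G c i
  toMonoCopy (f , inj , edge) = f , inj , edge

  fromMonoCopy : MonoCopy H G c i → ∃ (IsMonoCopy H G c i)
  fromMonoCopy (f , inj , edge) = f , inj , edge

MonoCopyAvoiding : ∀ {q h n} → Graph h → Graph n → Colouring q n → Fin q → List (Fin n) → Set
MonoCopyAvoiding {h = h} {n} H G c i Y =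
  Σ (Fin h → Fin n) λ f → IsMonoCopy H G c i f × (∀ x → f x ∉ Y)

module _ {q h n} {H : Graph h} {G : Graph n} {c : Colouring q n} {i : Fin q} where

  IsMonoCopy-resp : ∀ {f g} → f ≗ g → IsMonoCopy H G c i f → IsMonoCopy H G c i g
  IsMonoCopy-resp {f} {g} f≗g (f-inj , f-edge) = g-inj , g-edge
    where
    g-inj : Injective _≡_ _≡_ g
    g-inj e = f-inj (trans (f≗g _) (trans e (sym (f≗g _))))
    g-edge : ∀ x y → adj H x y ≡ true → adj G (g x) (g y) ≡ true × c (g x) (g y) ≡ i
    g-edge x y a rewrite sym (f≗g x) | sym (f≗g y) = f-edge x y a

  IsMonoCopy? : ∀ f → Dec (IsMonoCopy H G c i f)
  IsMonoCopy? f with injective? | edge?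
    where
    injective? : Dec (Injective _≡_ _≡_ f)
    injective? = map′ (λ inj {x} {y} → inj x y) (λ inj x y → inj {x} {y})
      (all? λ x → all? λ y → (f x Fin.≟ f y) →-dec (x Fin.≟ y))
    edge? : Dec (∀ x y → adj H x y ≡ true → adj G (f x) (f y) ≡ true × c (f x) (f y) ≡ i)
    edge? = all? λ x → all? λ y → (adj H x y Bool.≟ true) →-dec
      ((adj G (f x) (f y) Bool.≟ true) ×-dec (c (f x) (f y) Fin.≟ i))
  ... | yes inj  | yes edge = yes (inj , edge)
  ... | no ¬inj  | _        = no (¬inj ∘ IsMonoCopy.injective)
  ... | _        | no ¬edge = no (¬edge ∘ IsMonoCopy.edge)

  MonoCopy? : Dec (MonoCopy H G c i)
  MonoCopy? = map′ toMonoCopy fromMonoCopy (∃-map? h _ IsMonoCopy-resp IsMonoCopy?)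

  MonoCopyAvoiding? : ∀ Y → Dec (MonoCopyAvoiding H G c i Y)
  MonoCopyAvoiding? Y = ∃-map? h _
    (λ f≗g (mono , out) → IsMonoCopy-resp f≗g mono , λ x → subst (_∉ Y) (f≗g x) (out x))
    (λ f → IsMonoCopy? f ×-dec all? λ x → ¬? (f x ∈? Y))
    where open import Data.List.Membership.DecPropositional (Fin._≟_ {n}) using (_∈?_)

adj-K⇒≢ : ∀ {n} (x y : Fin n) → adj (K n) x y ≡ true → x ≢ y
adj-K⇒≢ x y a with x Fin.≟ y
adj-K⇒≢ x y () | yes _
... | no x≢y = x≢y

≢⇒adj-K : ∀ {n} (x y : Fin n) → x ≢ y → adj (K n) x y ≡ true
≢⇒adj-K x y x≢y rewrite dec-false (x Fin.≟ y) x≢y = refl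

IsMonoCopy-K-∘ : ∀ {q a k n} {G : Graph n} {c : Colouring q n} {i : Fin q} {f : Fin k → Fin n} →
  IsMonoCopy (K k) G c i f → (g : Fin a → Fin k) → Injective _≡_ _≡_ g →
  IsMonoCopy (K a) G c i (f ∘ g)
IsMonoCopy-K-∘ (f-inj , f-edge) g g-inj =
  g-inj ∘ f-inj ,
  λ x y a → f-edge (g x) (g y) (≢⇒adj-K (g x) (g y) (adj-K⇒≢ x y a ∘ g-inj))

IsMonoCopy-K0 : ∀ {q n} {G : Graph n} {c : Colouring q n} {i : Fin q} → IsMonoCopy (K 0) G c i []
IsMonoCopy-K0 = (λ { {()} }) , λ ()

joinMaps : ∀ {m₁ m₂ n} → (Fin m₁ → Fin n) → (Fin m₂ → Fin n) → Fin (m₁ + m₂) → Fin n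
joinMaps {m₁} f₁ f₂ = [ f₁ , f₂ ]′ ∘ splitAt m₁

module _ {q m₁ m₂ n} {H₁ : Graph m₁} {H₂ : Graph m₂} {G : Graph n}
         {c : Colouring q n} {i : Fin q} where

  ⊕-IsMonoCopy : ∀ {f₁ f₂} → IsMonoCopy H₁ G c i f₁ → IsMonoCopy H₂ G c i f₂ →
    (∀ x y → f₁ x ≢ f₂ y) → IsMonoCopy (H₁ ⊕ H₂) G c i (joinMaps f₁ f₂)
  ⊕-IsMonoCopy {f₁} {f₂} (f₁-inj , f₁-edge) (f₂-inj , f₂-edge) disjoint = inj , edge
    where
    [f₁,f₂]-injective : ∀ a b → [ f₁ , f₂ ]′ a ≡ [ f₁ , f₂ ]′ b → a ≡ b
    [f₁,f₂]-injective (inj₁ a) (inj₁ b) e = cong inj₁ (f₁-inj e)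
    [f₁,f₂]-injective (inj₂ a) (inj₂ b) e = cong inj₂ (f₂-inj e)
    [f₁,f₂]-injective (inj₁ a) (inj₂ b) e = ⊥-elim (disjoint a b e)
    [f₁,f₂]-injective (inj₂ a) (inj₁ b) e = ⊥-elim (disjoint b a (sym e))

    inj : Injective _≡_ _≡_ (joinMaps f₁ f₂)
    inj {u} {v} e = trans (sym (join-splitAt m₁ m₂ u))
      (trans (cong (join m₁ m₂) ([f₁,f₂]-injective (splitAt m₁ u) (splitAt m₁ v) e)) (join-splitAt m₁ m₂ v))

    edge : ∀ x y → adj (H₁ ⊕ H₂) x y ≡ true →
      adj G (joinMaps f₁ f₂ x) (joinMaps f₁ f₂ y) ≡ true × c (joinMaps f₁ f₂ x) (joinMaps f₁ f₂ y) ≡ i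
    edge x y a with splitAt m₁ x | splitAt m₁ y
    ... | inj₁ x₁ | inj₁ y₁ = f₁-edge x₁ y₁ a
    ... | inj₂ x₂ | inj₂ y₂ = f₂-edge x₂ y₂ a
    edge x y () | inj₁ _ | inj₂ _
    edge x y () | inj₂ _ | inj₁ _

  ⊕-IsMonoCopyˡ : ∀ {f} → IsMonoCopy (H₁ ⊕ H₂) G c i f → IsMonoCopy H₁ G c i (f ∘ (_↑ˡ m₂))
  ⊕-IsMonoCopyˡ (inj , edge) = ↑ˡ-injective m₂ _ _ ∘ inj ,
    λ x y a → edge (x ↑ˡ m₂) (y ↑ˡ m₂) (adj-↑ x y a)
    where
    adj-↑ : ∀ x y → adj H₁ x y ≡ true → adj (H₁ ⊕ H₂) (x ↑ˡ m₂) (y ↑ˡ m₂) ≡ true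
    adj-↑ x y a rewrite splitAt-↑ˡ m₁ x m₂ | splitAt-↑ˡ m₁ y m₂ = a

  ⊕-IsMonoCopyʳ : ∀ {f} → IsMonoCopy (H₁ ⊕ H₂) G c i f → IsMonoCopy H₂ G c i (f ∘ (m₁ ↑ʳ_))
  ⊕-IsMonoCopyʳ (inj , edge) = ↑ʳ-injective m₁ _ _ ∘ inj ,
    λ x y a → edge (m₁ ↑ʳ x) (m₁ ↑ʳ y) (adj-↑ x y a)
    where
    adj-↑ : ∀ x y → adj H₂ x y ≡ true → adj (H₁ ⊕ H₂) (m₁ ↑ʳ x) (m₁ ↑ʳ y) ≡ true
    adj-↑ x y a rewrite splitAt-↑ʳ m₁ m₂ x | splitAt-↑ʳ m₁ m₂ y = a

  ⊕-IsMonoCopy-disjoint : ∀ {f} → IsMonoCopy (H₁ ⊕ H₂) G c i f → ∀ x y → f (x ↑ˡ m₂) ≢ f (m₁ ↑ʳ y)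
  ⊕-IsMonoCopy-disjoint (inj , _) x y e with cong (splitAt m₁) (inj e)
  ... | e′ rewrite splitAt-↑ˡ m₁ x m₂ | splitAt-↑ʳ m₁ m₂ y with e′
  ... | ()

Transversal : ∀ {q n} (k t : ℕ) → Graph n → Colouring q n → List (Fin n) → Set
Transversal k t G c Y = ∀ i → ¬ MonoCopy (K k) G c i ⊎ ¬ MonoCopyAvoiding (K t) G c i Y

¬MonoCopyAvoiding-⊆ : ∀ {q h n} {H : Graph h} {G : Graph n} {c : Colouring q n} {i : Fin q} {Y Z} →
  (∀ {v} → v ∈ Y → v ∈ Z) → ¬ MonoCopyAvoiding H G c i Y → ¬ MonoCopyAvoiding H G c i Z
¬MonoCopyAvoiding-⊆ Y⊆Z ¬avoiding (f , mono , out) = ¬avoiding (f , mono , λ x → out x ∘ Y⊆Z)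

module _ {q n} {G : Graph n} {c : Colouring q n} {i : Fin q} (k t : ℕ) where

  KplusSK-extend : ∀ {j} {F : Fin (k + j * t) → Fin n} → IsMonoCopy (KplusSK k j t) G c i F →
    MonoCopyAvoiding (K t) G c i (tabulate F) → ∃ (IsMonoCopy (KplusSK k (suc j) t) G c i)
  KplusSK-extend {j} {F} F-mono (g , g-mono , g-out) =
    joinMaps L (joinMaps g R) ,
    ⊕-IsMonoCopy (⊕-IsMonoCopyˡ {H₂ = copies j (K t)} F-mono)
                 (⊕-IsMonoCopy g-mono (⊕-IsMonoCopyʳ {H₁ = K k} F-mono) (λ x y → g≢F x (k ↑ʳ y)))
                 L≢gR
    where
    L : Fin k → Fin n
    L = F ∘ (_↑ˡ j * t)
    R : Fin (j * t) → Fin n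
    R = F ∘ (k ↑ʳ_)
    g≢F : ∀ x y → g x ≢ F y
    g≢F x y e = g-out x (subst (_∈ tabulate F) (sym e) (∈-tabulate⁺ y))
    L≢gR : ∀ x z → L x ≢ joinMaps g R z
    L≢gR x z with splitAt t z
    ... | inj₁ z₁ = g≢F z₁ (x ↑ˡ j * t) ∘ sym
    ... | inj₂ z₂ = ⊕-IsMonoCopy-disjoint {H₁ = K k} {H₂ = copies j (K t)} F-mono x z₂

module _ {q n} {G : Graph n} {c : Colouring q n} (k t s : ℕ)
         (no-copy : ∀ i → ¬ MonoCopy (KplusSK k (suc s) t) G c i) where

  colour-transversal : ∀ i → ∃ λ Y → length Y ≤ k + s * t ×
    (¬ MonoCopy (K k) G c i ⊎ ¬ MonoCopyAvoiding (K t) G c i Y)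
  colour-transversal i with MonoCopy? {H = K k} {G = G} {c = c} {i = i}
  ... | no ¬K = List.[] , z≤n , inj₁ ¬K
  ... | yes K-copy with f , f-mono ← fromMonoCopy K-copy =
    Product.map₂ (Product.map₂ inj₂)
      (grow (suc s) 0 (+-identityʳ (suc s)) (joinMaps f [] , ⊕-IsMonoCopy f-mono IsMonoCopy-K0 λ _ ()))
    where
    grow : ∀ d j → d + j ≡ suc s → ∃ (IsMonoCopy (KplusSK k j t) G c i) →
      ∃ λ Y → length Y ≤ k + s * t × ¬ MonoCopyAvoiding (K t) G c i Y
    grow zero    j refl copy = ⊥-elim (no-copy i (toMonoCopy copy))
    grow (suc d) j d+j≡s (F , F-mono) with MonoCopyAvoiding? (tabulate F)
    ... | yes avoiding = grow d (suc j) (trans (+-suc d j) d+j≡s) (KplusSK-extend k t {j} F-mono avoiding)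
    ... | no ¬avoiding = tabulate F , length-bound , ¬avoiding
      where
      length-bound : length (tabulate F) ≤ k + s * t
      length-bound = ≤-trans (≤-reflexive (length-tabulate F))
        (+-monoʳ-≤ k (*-monoˡ-≤ t (subst (j ≤_) (ℕₚ.suc-injective d+j≡s) (m≤n+m j d))))

  transversal : ∃ λ Y → length Y ≤ q * (k + s * t) × Transversal k t G c Y
  transversal =
    concat (tabulate Yᵢ) ,
    length-concat-tabulate-≤ q Yᵢ (proj₁ ∘ proj₂ ∘ colour-transversal) ,
    λ i → Sum.map₂ (¬MonoCopyAvoiding-⊆ (λ v∈Yᵢ → ∈-concat⁺′ v∈Yᵢ (∈-tabulate⁺ i)))
                   (proj₂ (proj₂ (colour-transversal i)))
    where
    Yᵢ : Fin q → List (Fin n)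
    Yᵢ = proj₁ ∘ colour-transversal

firstThenRest-≢zero : ∀ {q a b} (j : Fin (suc q)) → j ≢ zero → firstThenRest (suc q) a b j ≡ b
firstThenRest-≢zero zero    j≢0 = contradiction refl j≢0
firstThenRest-≢zero (suc j) _   = refl

∸+1+≡suc : ∀ {t k} → t ≤ k → k ∸ t + 1 + t ≡ suc k
∸+1+≡suc {t} {k} t≤k = begin
  k ∸ t + 1 + t   ≡⟨ +-assoc (k ∸ t) 1 t ⟩
  k ∸ t + suc t   ≡⟨ +-suc (k ∸ t) t ⟩
  suc (k ∸ t + t) ≡⟨ cong suc (m∸n+n≡m t≤k) ⟩
  suc k           ∎
  where open ≡-Reasoning

module Recolouring {q n k t} {G : Graph n} {c : Colouring (suc q) n} (c-sym : SymColouring c)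
  (G-ramsey : IsRamsey (suc q) (K k) G) (t≤k : t ≤ k)
  (Y : List (Fin n)) (Y-transversal : Transversal k t G c Y)
  {i₀ : Fin (suc q)} (i₀-copy : MonoCopy (K k) G c i₀)
  (ψ : Colouring (suc q) (length Y)) (ψ-sym : SymColouring ψ)
  (ψ-good : ∀ j → ¬ MonoCopy (K (firstThenRest (suc q) (k ∸ t + 1) k j)) (K (length Y)) ψ j)
  where

  open import Data.List.Membership.DecPropositional (Fin._≟_ {n}) using (_∈?_)

  -- ψ's colour zero, in which even K_{k−t+1} is excluded, becomes i₀.
  π : Permutation′ (suc q)
  π = transpose zero i₀

  -- Y may contain repetitions; deciding u ∈? Y afresh makes the position independent of the proof.
  position : ∀ u → u ∈ Y → Fin (length Y)
  position u u∈Y with u ∈? Y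
  ... | yes p   = index p
  ... | no u∉Y  = contradiction u∈Y u∉Y

  lookup-position : ∀ u u∈Y → lookup Y (position u u∈Y) ≡ u
  lookup-position u u∈Y with u ∈? Y
  ... | yes p   = sym (lookup-index p)
  ... | no u∉Y  = contradiction u∈Y u∉Y

  c′ : Colouring (suc q) n
  c′ u v with u ∈? Y | v ∈? Y
  ... | yes p | yes p′ = π ⟨$⟩ʳ ψ (index p) (index p′)
  ... | yes _ | no _   = i₀
  ... | no _  | yes _  = i₀
  ... | no _  | no _   = c u v

  c′-sym : SymColouring c′
  c′-sym u v with u ∈? Y | v ∈? Y
  ... | yes p | yes p′ = cong (π ⟨$⟩ʳ_) (ψ-sym (index p) (index p′))
  ... | yes _ | no _   = refl
  ... | no _  | yes _  = refl
  ... | no _  | no _   = c-sym u v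

  c′-inside : ∀ u v u∈Y v∈Y → c′ u v ≡ π ⟨$⟩ʳ ψ (position u u∈Y) (position v v∈Y)
  c′-inside u v u∈Y v∈Y with u ∈? Y | v ∈? Y
  ... | yes _  | yes _  = refl
  ... | no u∉Y | _      = contradiction u∈Y u∉Y
  ... | yes _  | no v∉Y = contradiction v∈Y v∉Y

  c′-across : ∀ u v → u ∉ Y → v ∈ Y → c′ u v ≡ i₀
  c′-across u v u∉Y v∈Y with u ∈? Y | v ∈? Y
  ... | yes u∈Y | _      = contradiction u∈Y u∉Y
  ... | no _    | yes _  = refl
  ... | no _    | no v∉Y = contradiction v∈Y v∉Y

  c′-outside : ∀ u v → u ∉ Y → v ∉ Y → c′ u v ≡ c u v
  c′-outside u v u∉Y v∉Y with u ∈? Y | v ∈? Y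
  ... | yes u∈Y | _       = contradiction u∈Y u∉Y
  ... | no _    | yes v∈Y = contradiction v∈Y v∉Y
  ... | no _    | no _    = refl

  inside⇒ψ-copy : ∀ {a i f} → IsMonoCopy (K a) G c′ i f → (∀ x → f x ∈ Y) →
    MonoCopy (K a) (K (length Y)) ψ (π ⟨$⟩ˡ i)
  inside⇒ψ-copy {i = i} {f} (f-inj , f-edge) f-in =
    (λ x → position (f x) (f-in x)) , inj , λ x y a → ≢⇒adj-K _ _ (adj-K⇒≢ x y a ∘ inj) , colour x y a
    where
    inj : Injective _≡_ _≡_ (λ x → position (f x) (f-in x))
    inj {x} {y} e = f-inj (begin
      f x                             ≡⟨ lookup-position (f x) (f-in x) ⟨
      lookup Y (position (f x) (f-in x)) ≡⟨ cong (lookup Y) e ⟩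
      lookup Y (position (f y) (f-in y)) ≡⟨ lookup-position (f y) (f-in y) ⟩
      f y                             ∎)
      where open ≡-Reasoning
    colour : ∀ x y → adj (K _) x y ≡ true →
      ψ (position (f x) (f-in x)) (position (f y) (f-in y)) ≡ π ⟨$⟩ˡ i
    colour x y a = trans (sym (inverseˡ π))
      (cong (π ⟨$⟩ˡ_) (trans (sym (c′-inside _ _ (f-in x) (f-in y))) (proj₂ (f-edge x y a))))

  outside⇒c-copy : ∀ {a i f} → IsMonoCopy (K a) G c′ i f → (∀ x → f x ∉ Y) → IsMonoCopy (K a) G c i f
  outside⇒c-copy (f-inj , f-edge) f-out = f-inj , λ x y a →
    Product.map₂ (trans (sym (c′-outside _ _ (f-out x) (f-out y)))) (f-edge x y a)

  no-K-avoiding : ∀ i f → IsMonoCopy (K k) G c i f → ¬ (∀ x → f x ∉ Y)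
  no-K-avoiding i f f-mono f-out with Y-transversal i
  ... | inj₁ ¬K-copy    = ¬K-copy (toMonoCopy (f , f-mono))
  ... | inj₂ ¬avoiding = ¬avoiding (f ∘ ι , IsMonoCopy-K-∘ f-mono ι (inject≤-injective t≤k t≤k _ _) , f-out ∘ ι)
    where
    ι : Fin t → Fin k
    ι x = inject≤ x t≤k

  no-Kₜ-avoiding-in-i₀ : ¬ MonoCopyAvoiding (K t) G c i₀ Y
  no-Kₜ-avoiding-in-i₀ with Y-transversal i₀
  ... | inj₁ ¬K-copy    = contradiction i₀-copy ¬K-copy
  ... | inj₂ ¬avoiding = ¬avoiding

  no-c′-copy-in-i₀ : ∀ f → ¬ IsMonoCopy (K k) G c′ i₀ f
  no-c′-copy-in-i₀ f f-mono
    with Embeds-split k (λ x → f x ∈ Y) (λ x → f x ∈? Y) (k ∸ t + 1) t (≤-reflexive (∸+1+≡suc t≤k))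
  ... | inj₁ (g , g-inj , g-in) =
    ψ-good zero (subst (MonoCopy (K (k ∸ t + 1)) (K (length Y)) ψ) (inverseˡ π)
                       (inside⇒ψ-copy (IsMonoCopy-K-∘ f-mono g g-inj) g-in))
  ... | inj₂ (g , g-inj , g-out) =
    no-Kₜ-avoiding-in-i₀ (f ∘ g , outside⇒c-copy (IsMonoCopy-K-∘ f-mono g g-inj) g-out , g-out)

  no-c′-copy-in-other : ∀ i f → i ≢ i₀ → ¬ IsMonoCopy (K k) G c′ i f
  no-c′-copy-in-other i f i≢i₀ f-mono with all? (λ x → f x ∈? Y)
  ... | yes f-in = ψ-good (π ⟨$⟩ˡ i)
    (subst (λ r → MonoCopy (K r) (K (length Y)) ψ (π ⟨$⟩ˡ i)) (sym (firstThenRest-≢zero _ πi≢0))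
           (inside⇒ψ-copy f-mono f-in))
    where
    πi≢0 : π ⟨$⟩ˡ i ≢ zero
    πi≢0 πi≡0 = i≢i₀ (trans (sym (inverseʳ π)) (cong (π ⟨$⟩ʳ_) πi≡0))
  ... | no ¬f-in with x₀ , fx₀∉Y ← ¬∀⟶∃¬ k _ (λ x → f x ∈? Y) ¬f-in =
    no-K-avoiding i f (outside⇒c-copy f-mono f-out) f-out
    where
    f-out : ∀ y → f y ∉ Y
    f-out y fy∈Y = i≢i₀ (trans (sym (proj₂ (IsMonoCopy.edge f-mono x₀ y (≢⇒adj-K x₀ y x₀≢y))))
                               (c′-across _ _ fx₀∉Y fy∈Y))
      where
      x₀≢y : x₀ ≢ y
      x₀≢y refl = fx₀∉Y fy∈Y

  absurd : ⊥
  absurd with i , K-copy ← G-ramsey c′ c′-sym with f , f-mono ← fromMonoCopy K-copy | i Fin.≟ i₀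
  ... | yes refl = no-c′-copy-in-i₀ f f-mono
  ... | no i≢i₀  = no-c′-copy-in-other i f i≢i₀ f-mono

transversal⇒arrows : ∀ {q n k t} {G : Graph n} {c : Colouring q n} → SymColouring c →
  IsRamsey q (K k) G → t ≤ k → ∀ Y → Transversal k t G c Y →
  Arrows q (length Y) (firstThenRest q (k ∸ t + 1) k)
transversal⇒arrows {zero} {c = c} c-sym G-ramsey _ _ _ with () ← proj₁ (G-ramsey c c-sym)
transversal⇒arrows {suc q} {k = k} {t} {c = c} c-sym G-ramsey t≤k Y Y-transversal ψ ψ-sym
  with any? (λ j → MonoCopy? {H = K (firstThenRest (suc q) (k ∸ t + 1) k j)} {K (length Y)} {ψ} {j})
... | yes copy = copy
... | no ¬copy = ⊥-elim (Recolouring.absurd c-sym G-ramsey t≤k Y Y-transversal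
                           (proj₂ (G-ramsey c c-sym)) ψ ψ-sym (λ j → ¬copy ∘ (j ,_)))

q[k+st]≡qt[s+1]+q[k∸t] : ∀ {k t} q s → t ≤ k → q * (k + s * t) ≡ q * t * suc s + q * (k ∸ t)
q[k+st]≡qt[s+1]+q[k∸t] {k} {t} q s t≤k =
  subst (λ k′ → q * (k′ + s * t) ≡ q * t * suc s + q * (k′ ∸ t)) (m+[n∸m]≡n t≤k)
        (trans (expand q s t (k ∸ t)) (cong (λ d → q * t * suc s + q * d) (sym (m+n∸m≡n t (k ∸ t)))))
  where
  expand : ∀ q s t d → q * ((t + d) + s * t) ≡ q * t * suc s + q * d
  expand = solve-∀

ramsey-K⇒ramsey-KplusSK : ∀ {q k t s r n} (G : Graph n) → t ≤ k →
  IsRamseyNumber q (firstThenRest q (k ∸ t + 1) k) r → q * t * s + q * (k ∸ t) < r →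
  IsRamsey q (K k) G → IsRamsey q (KplusSK k s t) G
ramsey-K⇒ramsey-KplusSK {k = k} {s = zero} G _ _ _ G-ramsey c c-sym
  with i , K-copy ← G-ramsey c c-sym with f , f-mono ← fromMonoCopy {H = K k} {G} {c} {i} K-copy =
  i , toMonoCopy (joinMaps f [] , ⊕-IsMonoCopy f-mono IsMonoCopy-K0 λ _ ())
ramsey-K⇒ramsey-KplusSK {q} {k} {t} {suc s} {r} G t≤k (_ , r-minimal) size G-ramsey c c-sym
  with any? (λ i → MonoCopy? {H = KplusSK k (suc s) t} {G} {c} {i})
... | yes copy = copy
... | no ¬copy with Y , |Y|≤ , Y-transversal ← transversal {G = G} {c} k t s (λ i → ¬copy ∘ (i ,_)) =
  contradiction (r-minimal (length Y) (transversal⇒arrows {G = G} {c} c-sym G-ramsey t≤k Y Y-transversal))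
                (<⇒≱ (≤-<-trans |Y|≤ (subst (_< r) (sym (q[k+st]≡qt[s+1]+q[k∸t] q s t≤k)) size)))

ramsey-KplusSK⇒ramsey-K : ∀ {q k s t n} (G : Graph n) → IsRamsey q (KplusSK k s t) G → IsRamsey q (K k) G
ramsey-KplusSK⇒ramsey-K {k = k} {s} {t} G G-ramsey c c-sym
  with i , copy ← G-ramsey c c-sym with F , F-mono ← fromMonoCopy {H = KplusSK k s t} {G} {c} {i} copy =
  i , toMonoCopy (_ , ⊕-IsMonoCopyˡ F-mono)

ramsey-equivalent⇒QEquivalent : ∀ {q h h′} {H : Graph h} {H′ : Graph h′} →
  (∀ {n} (G : Graph n) → IsRamsey q H G → IsRamsey q H′ G) →
  (∀ {n} (G : Graph n) → IsRamsey q H′ G → IsRamsey q H G) →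
  QEquivalent q H H′
ramsey-equivalent⇒QEquivalent H⇒H′ H′⇒H n G =
  (λ (ramsey , minimal) → H⇒H′ G ramsey , λ m G′ g sub ¬whole → minimal m G′ g sub ¬whole ∘ H′⇒H G′) ,
  (λ (ramsey , minimal) → H′⇒H G ramsey , λ m G′ g sub ¬whole → minimal m G′ g sub ¬whole ∘ H⇒H′ G′)

theorem1p8 : (k t q s r : ℕ) → 2 ≤ q → 2 ≤ t → t < k →
    IsRamseyNumber q (firstThenRest q (k ∸ t + 1) k) r →
    q * t * s + q * (k ∸ t) < r →
    QEquivalent q (K k) (KplusSK k s t)
theorem1p8 k t q s r _ _ t<k r-ramsey size =
  ramsey-equivalent⇒QEquivalent {q} {H = K k} {KplusSK k s t}
    (λ G → ramsey-K⇒ramsey-KplusSK G (<⇒≤ t<k) r-ramsey size)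
    (ramsey-KplusSK⇒ramsey-K {k = k} {s} {t})
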